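{- Let $p$ be a prime, $n\ge 1$, and $k\ge 0$ an integer with $p^k\le n$. Let $H_m=\sum_{i=1}^m 1/i$ (with $H_0=0$). Then the exact power of $p$ dividing the denominator (in lowest terms) of the rational number $$\binom{n}{p^k}\left(H_n-H_{n-p^k}\right)$$ is $p^k$; equivalently, its $p$-adic valuation equals $-k$. -}

module Defs where

open import Data.Nat using (ℕ; zero; suc)
open import Data.Integer using (+_)
open import Data.Rational using (ℚ; _/_; _+_; 0ℚ)

H : ℕ → ℚ
H zero    = 0ℚ
H (suc m) = H m + ((+ 1) / suc m)

-- C(n,m)·(Hₙ − Hₙ₋ₘ) is the coefficient of xᵐ in (1 + x)ⁿ log (1 + x) (differentiate (1 + x)ⁿ in n),
-- so it equals ∑_{i<m} (-1)^(m-i+1)/(m-i) · C(n,i); both sides satisfy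
-- (m+1)·X(m+1) + m·X(m) = n·X(m) + C(n,m) and agree at m = 0. For m = pᵏ the i = 0 term is ±1/pᵏ,
-- while every other term has a denominator m − i < pᵏ of p-adic valuation below k. Hence pᵏ times the
-- sum is a p-adic unit, and this fixes the exact power of p in the reduced denominator.
module Submission where

open import Defs
open import Data.Nat using (ℕ; _≤_; _^_; _∸_; suc)
open import Data.Nat.Divisibility using (_∣_)
open import Data.Nat.Primality using (Prime)
open import Data.Nat.Combinatorics using (_C_)
open import Data.Integer using (+_)
open import Data.Rational using (ℚ; _*_; _-_; _/_; ↧ₙ_)
open import Data.Product using (_×_)
open import Relation.Nullary using (¬_)

open import Algebra.Bundles using (Ring; CommutativeRing)
open import Data.Empty using (⊥-elim)
open import Data.Fin as Fin using (Fin; toℕ)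
import Data.Fin.Properties as Fin
open import Data.Integer as ℤ using (ℤ)
import Data.Integer.Divisibility.Signed as ℤ∣
import Data.Integer.Properties as ℤ
open import Data.Maybe using (Maybe; just; nothing)
open import Data.Nat as ℕ using (zero; _<_; s≤s)
open import Data.Nat.Combinatorics using (nC1≡n; k>n⇒nCk≡0; nCk+nC[k+1]≡[n+1]C[k+1])
open import Data.Nat.Coprimality as Coprime using (Coprime; coprime-divisor)
open import Data.Nat.Divisibility using (divides; _∣?_; ∣1⇒≡1; 1∣_; ∣-trans; m∣m*n; n∣m*n; *-monoʳ-∣; *-cancelˡ-∣)
open import Data.Nat.Primality using (prime⇒nonZero; prime⇒nonTrivial; euclidsLemma)
import Data.Nat.Properties as ℕ
open import Data.Nat.Tactic.RingSolver renaming (solve-∀ to ℕ-solve-∀)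
open import Data.Product using (_,_; ∃; ∃₂)
open import Data.Rational using (_+_; 0ℚ; 1ℚ; toℚᵘ; mkℚ; ↥_)
import Data.Rational.Properties as ℚ
import Data.Rational.Unnormalised as ℚᵘ
import Data.Rational.Unnormalised.Properties as ℚᵘ
open import Data.Sum using (inj₁; inj₂)
open import Function using (_∘_)
open import Relation.Binary.PropositionalEquality
open import Relation.Nullary using (yes; no)
import Tactic.RingSolver.Core.AlmostCommutativeRing as ACR
open import Tactic.RingSolver using (solve-∀)

open import Algebra.Properties.Semiring.Sum (Ring.semiring ℚ.+-*-ring)
  using (sum; sum-syntax; sum-cong-≗; ∑-distrib-+; *-distribˡ-sum; *-distribʳ-sum; sum-init-last; sum-replicate-zero)
open import Algebra.Properties.CommutativeSemigroup (CommutativeRing.*-commutativeSemigroup ℚ.+-*-commutativeRing)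
  using (x∙yz≈y∙xz; xy∙z≈xz∙y; xy∙z≈y∙xz; xy∙z≈yz∙x)
open import Algebra.Properties.CommutativeSemigroup (CommutativeRing.+-commutativeSemigroup ℚ.+-*-commutativeRing)
  using () renaming (interchange to +-interchange; xy∙z≈xz∙y to +-xy∙z≈xz∙y)
open import Algebra.Properties.Group (Ring.+-group ℚ.+-*-ring) using (∙-cancelʳ)

ℚ-ring : ACR.AlmostCommutativeRing _ _
ℚ-ring = ACR.fromCommutativeRing ℚ.+-*-commutativeRing isZero
  where
  isZero : ∀ x → Maybe (0ℚ ≡ x)
  isZero x with x ℚ.≟ 0ℚ
  ... | yes x≡0 = just (sym x≡0)
  ... | no _    = nothing

fromℤ : ℤ → ℚ
fromℤ a = a / 1

fromℕ : ℕ → ℚ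
fromℕ n = fromℤ (+ n)

-- recip 0 = 0 is a junk value; H (suc m) = H m + recip (suc m) holds definitionally.
recip : ℕ → ℚ
recip zero    = 0ℚ
recip (suc m) = + 1 / suc m

toℚᵘ-fromℤ : ∀ a → toℚᵘ (fromℤ a) ℚᵘ.≃ ℚᵘ.mkℚᵘ a 0
toℚᵘ-fromℤ a = ℚ.toℚᵘ-fromℚᵘ (ℚᵘ.mkℚᵘ a 0)

fromℤ-+ : ∀ a b → fromℤ (a ℤ.+ b) ≡ fromℤ a + fromℤ b
fromℤ-+ a b = ℚ.toℚᵘ-injective (begin-equality
  toℚᵘ (fromℤ (a ℤ.+ b))                ≃⟨ toℚᵘ-fromℤ (a ℤ.+ b) ⟩
  ℚᵘ.mkℚᵘ (a ℤ.+ b) 0                   ≃⟨ ℚᵘ.*≡* (cong (ℤ._* ℤ.1ℤ) (sym (cong₂ ℤ._+_ (ℤ.*-identityʳ a) (ℤ.*-identityʳ b)))) ⟩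
  ℚᵘ.mkℚᵘ a 0 ℚᵘ.+ ℚᵘ.mkℚᵘ b 0          ≃⟨ ℚᵘ.+-cong (toℚᵘ-fromℤ a) (toℚᵘ-fromℤ b) ⟨
  toℚᵘ (fromℤ a) ℚᵘ.+ toℚᵘ (fromℤ b)    ≃⟨ ℚ.toℚᵘ-homo-+ (fromℤ a) (fromℤ b) ⟨
  toℚᵘ (fromℤ a + fromℤ b)              ∎)
  where open ℚᵘ.≤-Reasoning

fromℤ-* : ∀ a b → fromℤ (a ℤ.* b) ≡ fromℤ a * fromℤ b
fromℤ-* a b = ℚ.toℚᵘ-injective (begin-equality
  toℚᵘ (fromℤ (a ℤ.* b))                ≃⟨ toℚᵘ-fromℤ (a ℤ.* b) ⟩
  ℚᵘ.mkℚᵘ a 0 ℚᵘ.* ℚᵘ.mkℚᵘ b 0          ≃⟨ ℚᵘ.*-cong (toℚᵘ-fromℤ a) (toℚᵘ-fromℤ b) ⟨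
  toℚᵘ (fromℤ a) ℚᵘ.* toℚᵘ (fromℤ b)    ≃⟨ ℚ.toℚᵘ-homo-* (fromℤ a) (fromℤ b) ⟨
  toℚᵘ (fromℤ a * fromℤ b)              ∎)
  where open ℚᵘ.≤-Reasoning

fromℕ-+ : ∀ m n → fromℕ (m ℕ.+ n) ≡ fromℕ m + fromℕ n
fromℕ-+ m n = trans (cong fromℤ (ℤ.pos-+ m n)) (fromℤ-+ (+ m) (+ n))

fromℕ-* : ∀ m n → fromℕ (m ℕ.* n) ≡ fromℕ m * fromℕ n
fromℕ-* m n = trans (cong fromℤ (ℤ.pos-* m n)) (fromℤ-* (+ m) (+ n))

fromℕ*recip : ∀ m → fromℕ (suc m) * recip (suc m) ≡ 1ℚ
fromℕ*recip m = ℚ.toℚᵘ-injective (begin-equality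
  toℚᵘ (fromℕ (suc m) * recip (suc m))                 ≃⟨ ℚ.toℚᵘ-homo-* (fromℕ (suc m)) (recip (suc m)) ⟩
  toℚᵘ (fromℕ (suc m)) ℚᵘ.* toℚᵘ (recip (suc m))       ≃⟨ ℚᵘ.*-cong (toℚᵘ-fromℤ (+ suc m)) (ℚ.toℚᵘ-fromℚᵘ (ℚᵘ.mkℚᵘ (+ 1) m)) ⟩
  ℚᵘ.mkℚᵘ (+ suc m) 0 ℚᵘ.* ℚᵘ.mkℚᵘ (+ 1) m             ≃⟨ ℚᵘ.*≡* (cong (λ d → + suc d) (m*1*1≡m+0+0 m)) ⟩
  ℚᵘ.1ℚᵘ                                               ∎)
  where
  open ℚᵘ.≤-Reasoning
  m*1*1≡m+0+0 : ∀ m → m ℕ.* 1 ℕ.* 1 ≡ m ℕ.+ 0 ℕ.+ 0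
  m*1*1≡m+0+0 = ℕ-solve-∀

recip*fromℕ*-cancel : ∀ m x → recip (suc m) * (fromℕ (suc m) * x) ≡ x
recip*fromℕ*-cancel m x = begin
  recip (suc m) * (fromℕ (suc m) * x)   ≡⟨ ℚ.*-assoc (recip (suc m)) _ x ⟨
  (recip (suc m) * fromℕ (suc m)) * x   ≡⟨ cong (_* x) (ℚ.*-comm (recip (suc m)) _) ⟩
  (fromℕ (suc m) * recip (suc m)) * x   ≡⟨ cong (_* x) (fromℕ*recip m) ⟩
  1ℚ * x                                ≡⟨ ℚ.*-identityˡ x ⟩
  x                                     ∎
  where open ≡-Reasoning

fromℕ-suc-*-cancelˡ : ∀ m {x y} → fromℕ (suc m) * x ≡ fromℕ (suc m) * y → x ≡ y
fromℕ-suc-*-cancelˡ m {x} {y} eq =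
  trans (sym (recip*fromℕ*-cancel m x)) (trans (cong (recip (suc m) *_) eq) (recip*fromℕ*-cancel m y))

[1+k]*nC[1+k]+k*nCk≡n*nCk : ∀ n k → suc k ℕ.* (n C suc k) ℕ.+ k ℕ.* (n C k) ≡ n ℕ.* (n C k)
[1+k]*nC[1+k]+k*nCk≡n*nCk zero    zero    = refl
[1+k]*nC[1+k]+k*nCk≡n*nCk zero    (suc k) = cong₂ ℕ._+_ (m*0C[1+j]≡0 (2 ℕ.+ k) (suc k)) (m*0C[1+j]≡0 (suc k) k)
  where
  m*0C[1+j]≡0 : ∀ m j → m ℕ.* (0 C suc j) ≡ 0
  m*0C[1+j]≡0 m j = trans (cong (m ℕ.*_) (k>n⇒nCk≡0 {0} {suc j} ℕ.z<s)) (ℕ.*-zeroʳ m)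
[1+k]*nC[1+k]+k*nCk≡n*nCk (suc n) zero    = trans (ℕ.+-identityʳ _) (trans (ℕ.*-identityˡ _) (trans (nC1≡n (suc n)) (sym (ℕ.*-identityʳ _))))
[1+k]*nC[1+k]+k*nCk≡n*nCk (suc n) (suc k) = begin
  (2 ℕ.+ k) ℕ.* (suc n C (2 ℕ.+ k)) ℕ.+ (1 ℕ.+ k) ℕ.* (suc n C suc k)
    ≡⟨ cong₂ (λ a b → (2 ℕ.+ k) ℕ.* a ℕ.+ (1 ℕ.+ k) ℕ.* b) (pascal (suc k)) (pascal k) ⟨
  (2 ℕ.+ k) ℕ.* (X ℕ.+ Y) ℕ.+ (1 ℕ.+ k) ℕ.* (W ℕ.+ X)
    ≡⟨ regroup k W X Y ⟩
  ((2 ℕ.+ k) ℕ.* Y ℕ.+ (1 ℕ.+ k) ℕ.* X) ℕ.+ ((1 ℕ.+ k) ℕ.* X ℕ.+ k ℕ.* W) ℕ.+ (W ℕ.+ X)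
    ≡⟨ cong₂ (λ a b → a ℕ.+ b ℕ.+ (W ℕ.+ X)) ([1+k]*nC[1+k]+k*nCk≡n*nCk n (suc k)) ([1+k]*nC[1+k]+k*nCk≡n*nCk n k) ⟩
  n ℕ.* X ℕ.+ n ℕ.* W ℕ.+ (W ℕ.+ X)
    ≡⟨ collect n W X ⟩
  suc n ℕ.* (W ℕ.+ X)
    ≡⟨ cong (suc n ℕ.*_) (pascal k) ⟩
  suc n ℕ.* (suc n C suc k)
    ∎
  where
  open ≡-Reasoning
  W = n C k
  X = n C suc k
  Y = n C suc (suc k)
  pascal : ∀ k → n C k ℕ.+ n C suc k ≡ suc n C suc k
  pascal = nCk+nC[k+1]≡[n+1]C[k+1] n
  regroup : ∀ k W X Y → (2 ℕ.+ k) ℕ.* (X ℕ.+ Y) ℕ.+ (1 ℕ.+ k) ℕ.* (W ℕ.+ X)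
                        ≡ ((2 ℕ.+ k) ℕ.* Y ℕ.+ (1 ℕ.+ k) ℕ.* X) ℕ.+ ((1 ℕ.+ k) ℕ.* X ℕ.+ k ℕ.* W) ℕ.+ (W ℕ.+ X)
  regroup = ℕ-solve-∀
  collect : ∀ n W X → n ℕ.* X ℕ.+ n ℕ.* W ℕ.+ (W ℕ.+ X) ≡ suc n ℕ.* (W ℕ.+ X)
  collect = ℕ-solve-∀

sign : ℕ → ℤ
sign zero    = ℤ.-1ℤ
sign (suc j) = ℤ.- sign j

-- The coefficient of xʲ in log (1 + x) = ∑ (-1)ʲ⁺¹ xʲ / j.
logCoeff : ℕ → ℚ
logCoeff j = fromℤ (sign j) * recip j

fromℕ*logCoeff : ∀ j → fromℕ (suc j) * logCoeff (suc j) ≡ fromℤ (sign (suc j))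
fromℕ*logCoeff j = begin
  fromℕ (suc j) * (σ * recip (suc j))   ≡⟨ x∙yz≈y∙xz (fromℕ (suc j)) σ (recip (suc j)) ⟩
  σ * (fromℕ (suc j) * recip (suc j))   ≡⟨ cong (σ *_) (fromℕ*recip j) ⟩
  σ * 1ℚ                                ≡⟨ ℚ.*-identityʳ σ ⟩
  σ                                     ∎
  where
  open ≡-Reasoning
  σ = fromℤ (sign (suc j))

sign-suc-cancel : ∀ j x → fromℤ (sign (suc j)) * x + fromℤ (sign j) * x ≡ 0ℚ
sign-suc-cancel j x = begin
  fromℤ (ℤ.- sign j) * x + fromℤ (sign j) * x   ≡⟨ ℚ.*-distribʳ-+ x (fromℤ (ℤ.- sign j)) (fromℤ (sign j)) ⟨
  (fromℤ (ℤ.- sign j) + fromℤ (sign j)) * x     ≡⟨ cong (_* x) (fromℤ-+ (ℤ.- sign j) (sign j)) ⟨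
  fromℤ (ℤ.- sign j ℤ.+ sign j) * x             ≡⟨ cong (λ a → fromℤ a * x) (ℤ.+-inverseˡ (sign j)) ⟩
  0ℚ * x                                        ≡⟨ ℚ.*-zeroˡ x ⟩
  0ℚ                                            ∎
  where open ≡-Reasoning

∣sign∣≡1 : ∀ j → ℤ.∣ sign j ∣ ≡ 1
∣sign∣≡1 zero    = refl
∣sign∣≡1 (suc j) = trans (ℤ.∣-i∣≡∣i∣ (sign j)) (∣sign∣≡1 j)

fromℕ[u+i]*logCoeff : ∀ u i x → 0 < u →
                      fromℕ (u ℕ.+ i) * (logCoeff u * x) ≡ fromℤ (sign u) * x + fromℕ i * (logCoeff u * x)
fromℕ[u+i]*logCoeff (suc j) i x _ = begin
  fromℕ (suc j ℕ.+ i) * (e * x)                  ≡⟨ cong (_* (e * x)) (fromℕ-+ (suc j) i) ⟩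
  (fromℕ (suc j) + fromℕ i) * (e * x)            ≡⟨ distrib (fromℕ (suc j)) (fromℕ i) e x ⟩
  (fromℕ (suc j) * e) * x + fromℕ i * (e * x)    ≡⟨ cong (λ y → y * x + fromℕ i * (e * x)) (fromℕ*logCoeff j) ⟩
  fromℤ (sign (suc j)) * x + fromℕ i * (e * x)   ∎
  where
  open ≡-Reasoning
  e = logCoeff (suc j)
  distrib : ∀ a b e x → (a + b) * (e * x) ≡ (a * e) * x + b * (e * x)
  distrib = solve-∀ ℚ-ring

H-gap : ∀ m r → H m - H r ≡ (H m - H (suc r)) + recip (suc r)
H-gap m r = a-b≡[a-[b+d]]+d (H m) (H r) (recip (suc r))
  where
  a-b≡[a-[b+d]]+d : ∀ a b d → a - b ≡ (a - (b + d)) + d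
  a-b≡[a-[b+d]]+d = solve-∀ ℚ-ring

module _ (n : ℕ) where

  binom : ℕ → ℚ
  binom i = fromℕ (n C i)

  binom-absorption : ∀ i → fromℕ (suc i) * binom (suc i) + fromℕ i * binom i ≡ fromℕ n * binom i
  binom-absorption i = begin
    fromℕ (suc i) * binom (suc i) + fromℕ i * binom i
      ≡⟨ cong₂ _+_ (fromℕ-* (suc i) (n C suc i)) (fromℕ-* i (n C i)) ⟨
    fromℕ (suc i ℕ.* (n C suc i)) + fromℕ (i ℕ.* (n C i))
      ≡⟨ fromℕ-+ (suc i ℕ.* (n C suc i)) (i ℕ.* (n C i)) ⟨
    fromℕ (suc i ℕ.* (n C suc i) ℕ.+ i ℕ.* (n C i))
      ≡⟨ cong fromℕ ([1+k]*nC[1+k]+k*nCk≡n*nCk n i) ⟩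
    fromℕ (n ℕ.* (n C i))
      ≡⟨ fromℕ-* n (n C i) ⟩
    fromℕ n * binom i
      ∎
    where open ≡-Reasoning

  binomialHarmonic : ℕ → ℚ
  binomialHarmonic m = binom m * (H n - H (n ∸ m))

  logTerm signTerm : ℕ → ℕ → ℚ
  logTerm  t i = logCoeff (t ∸ i) * binom i
  signTerm t i = fromℤ (sign (t ∸ i)) * binom i

  logConvolution : ℕ → ℚ
  logConvolution t = ∑[ i < t ] logTerm t (toℕ i)

  signedPart weightedPart : ℕ → ℚ
  signedPart   t = ∑[ i < t ] signTerm t (toℕ i)
  weightedPart t = ∑[ i < t ] (fromℕ (toℕ i) * logTerm t (toℕ i))

  fromℕ*logConvolution : ∀ t → fromℕ t * logConvolution t ≡ signedPart t + weightedPart t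
  fromℕ*logConvolution t = begin
    fromℕ t * logConvolution t                   ≡⟨ *-distribˡ-sum {t} (fromℕ t) (logTerm t ∘ toℕ) ⟩
    ∑[ i < t ] (fromℕ t * logTerm t (toℕ i))     ≡⟨ sum-cong-≗ {t} termwise ⟩
    ∑[ i < t ] (signTerm t (toℕ i) + fromℕ (toℕ i) * logTerm t (toℕ i))
                                                 ≡⟨ ∑-distrib-+ {t} (signTerm t ∘ toℕ) (λ i → fromℕ (toℕ i) * logTerm t (toℕ i)) ⟩
    signedPart t + weightedPart t                ∎
    where
    open ≡-Reasoning
    termwise : ∀ (i : Fin t) → fromℕ t * logTerm t (toℕ i) ≡ signTerm t (toℕ i) + fromℕ (toℕ i) * logTerm t (toℕ i)
    termwise i = trans
      (cong (λ m → fromℕ m * logTerm t (toℕ i)) (sym (ℕ.m∸n+n≡m (ℕ.<⇒≤ (Fin.toℕ<n i)))))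
      (fromℕ[u+i]*logCoeff (t ∸ toℕ i) (toℕ i) (binom (toℕ i)) (ℕ.m<n⇒0<n∸m (Fin.toℕ<n i)))

  signedPart-step : ∀ t → signedPart (suc t) + signedPart t ≡ binom t
  signedPart-step t = begin
    signedPart (suc t) + signedPart t
      ≡⟨ cong (_+ signedPart t) (sum-init-last {t} (signTerm (suc t) ∘ toℕ)) ⟩
    (∑[ i < t ] signTerm (suc t) (toℕ (Fin.inject₁ i)) + lastTerm) + signedPart t
      ≡⟨ +-xy∙z≈xz∙y (∑[ i < t ] signTerm (suc t) (toℕ (Fin.inject₁ i))) lastTerm (signedPart t) ⟩
    (∑[ i < t ] signTerm (suc t) (toℕ (Fin.inject₁ i)) + signedPart t) + lastTerm
      ≡⟨ cong (_+ lastTerm) (∑-distrib-+ {t} (signTerm (suc t) ∘ toℕ ∘ Fin.inject₁) (signTerm t ∘ toℕ)) ⟨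
    ∑[ i < t ] (signTerm (suc t) (toℕ (Fin.inject₁ i)) + signTerm t (toℕ i)) + lastTerm
      ≡⟨ cong (_+ lastTerm) (trans (sum-cong-≗ {t} pairs-cancel) (sum-replicate-zero t)) ⟩
    0ℚ + lastTerm
      ≡⟨ ℚ.+-identityˡ lastTerm ⟩
    lastTerm
      ≡⟨ cong (signTerm (suc t)) (Fin.toℕ-fromℕ t) ⟩
    fromℤ (sign (suc t ∸ t)) * binom t
      ≡⟨ cong (λ j → fromℤ (sign j) * binom t) (ℕ.m+n∸n≡m 1 t) ⟩
    1ℚ * binom t
      ≡⟨ ℚ.*-identityˡ (binom t) ⟩
    binom t
      ∎
    where
    open ≡-Reasoning
    lastTerm = signTerm (suc t) (toℕ (Fin.fromℕ t))
    pairs-cancel : ∀ (i : Fin t) → signTerm (suc t) (toℕ (Fin.inject₁ i)) + signTerm t (toℕ i) ≡ 0ℚ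
    pairs-cancel i rewrite Fin.toℕ-inject₁ i | ℕ.+-∸-assoc 1 (ℕ.<⇒≤ (Fin.toℕ<n i)) =
      sign-suc-cancel (t ∸ toℕ i) (binom (toℕ i))

  weightedPart-step : ∀ t → weightedPart (suc t) + weightedPart t ≡ fromℕ n * logConvolution t
  weightedPart-step t = begin
    weightedPart (suc t) + weightedPart t
      ≡⟨ cong (_+ weightedPart t) (trans (cong (_+ shifted) (ℚ.*-zeroˡ (logTerm (suc t) 0))) (ℚ.+-identityˡ shifted)) ⟩
    shifted + weightedPart t
      ≡⟨ ∑-distrib-+ {t} (λ i → fromℕ (suc (toℕ i)) * logTerm (suc t) (suc (toℕ i))) (λ i → fromℕ (toℕ i) * logTerm t (toℕ i)) ⟨
    ∑[ i < t ] (fromℕ (suc (toℕ i)) * logTerm (suc t) (suc (toℕ i)) + fromℕ (toℕ i) * logTerm t (toℕ i))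
      ≡⟨ sum-cong-≗ {t} (λ i → absorb (toℕ i)) ⟩
    ∑[ i < t ] (fromℕ n * logTerm t (toℕ i))
      ≡⟨ *-distribˡ-sum {t} (fromℕ n) (logTerm t ∘ toℕ) ⟨
    fromℕ n * logConvolution t
      ∎
    where
    open ≡-Reasoning
    shifted = ∑[ i < t ] (fromℕ (suc (toℕ i)) * logTerm (suc t) (suc (toℕ i)))
    regroup : ∀ a b c d e → a * (e * b) + c * (e * d) ≡ e * (a * b + c * d)
    regroup = solve-∀ ℚ-ring
    absorb : ∀ i → fromℕ (suc i) * (logCoeff (t ∸ i) * binom (suc i)) + fromℕ i * logTerm t i ≡ fromℕ n * logTerm t i
    absorb i = begin
      fromℕ (suc i) * (e * binom (suc i)) + fromℕ i * (e * binom i)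
        ≡⟨ regroup (fromℕ (suc i)) (binom (suc i)) (fromℕ i) (binom i) e ⟩
      e * (fromℕ (suc i) * binom (suc i) + fromℕ i * binom i)
        ≡⟨ cong (e *_) (binom-absorption i) ⟩
      e * (fromℕ n * binom i)
        ≡⟨ x∙yz≈y∙xz e (fromℕ n) (binom i) ⟩
      fromℕ n * (e * binom i)
        ∎
      where e = logCoeff (t ∸ i)

  logConvolution-step : ∀ t → fromℕ (suc t) * logConvolution (suc t) + fromℕ t * logConvolution t
                              ≡ fromℕ n * logConvolution t + binom t
  logConvolution-step t = begin
    fromℕ (suc t) * logConvolution (suc t) + fromℕ t * logConvolution t
      ≡⟨ cong₂ _+_ (fromℕ*logConvolution (suc t)) (fromℕ*logConvolution t) ⟩
    (signedPart (suc t) + weightedPart (suc t)) + (signedPart t + weightedPart t)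
      ≡⟨ +-interchange (signedPart (suc t)) (weightedPart (suc t)) (signedPart t) (weightedPart t) ⟩
    (signedPart (suc t) + signedPart t) + (weightedPart (suc t) + weightedPart t)
      ≡⟨ cong₂ _+_ (signedPart-step t) (weightedPart-step t) ⟩
    binom t + fromℕ n * logConvolution t
      ≡⟨ ℚ.+-comm (binom t) (fromℕ n * logConvolution t) ⟩
    fromℕ n * logConvolution t + binom t
      ∎
    where open ≡-Reasoning

  binomialHarmonic-step : ∀ t → t < n → fromℕ (suc t) * binomialHarmonic (suc t) + fromℕ t * binomialHarmonic t
                                        ≡ fromℕ n * binomialHarmonic t + binom t
  binomialHarmonic-step t t<n = begin
    fromℕ (suc t) * (binom (suc t) * (H n - H (n ∸ suc t))) + T * (c * y)
      ≡⟨ cong (λ z → fromℕ (suc t) * (binom (suc t) * z) + T * (c * y)) gap ⟩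
    fromℕ (suc t) * (binom (suc t) * (y + d)) + T * (c * y)
      ≡⟨ expand (fromℕ (suc t)) (binom (suc t)) T c y d ⟩
    (fromℕ (suc t) * binom (suc t) + T * c) * (y + d) - c * (T * d)
      ≡⟨ cong (λ z → z * (y + d) - c * (T * d)) (trans (binom-absorption t) (cong (_* c) N≡U+T)) ⟩
    (U + T) * c * (y + d) - c * (T * d)
      ≡⟨ collect U T c y d ⟩
    (U + T) * (c * y) + c * (U * d)
      ≡⟨ cong₂ (λ a b → a * (c * y) + c * b) (sym N≡U+T) U*d≡1 ⟩
    fromℕ n * (c * y) + c * 1ℚ
      ≡⟨ cong (λ z → fromℕ n * (c * y) + z) (ℚ.*-identityʳ c) ⟩
    fromℕ n * (c * y) + c
      ∎
    where
    open ≡-Reasoning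
    u = n ∸ t
    T = fromℕ t
    U = fromℕ u
    c = binom t
    y = H n - H u
    d = recip u
    u≡1+r : u ≡ suc (n ∸ suc t)
    u≡1+r = ℕ.+-∸-assoc 1 t<n
    gap : H n - H (n ∸ suc t) ≡ y + d
    gap = trans (H-gap n (n ∸ suc t)) (cong (λ m → (H n - H m) + recip m) (sym u≡1+r))
    U*d≡1 : U * d ≡ 1ℚ
    U*d≡1 = subst (λ m → fromℕ m * recip m ≡ 1ℚ) (sym u≡1+r) (fromℕ*recip (n ∸ suc t))
    N≡U+T : fromℕ n ≡ U + T
    N≡U+T = trans (cong fromℕ (sym (ℕ.m∸n+n≡m (ℕ.<⇒≤ t<n)))) (fromℕ-+ u t)
    expand : ∀ a b T c y d → a * (b * (y + d)) + T * (c * y) ≡ (a * b + T * c) * (y + d) - c * (T * d)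
    expand = solve-∀ ℚ-ring
    collect : ∀ U T c y d → (U + T) * c * (y + d) - c * (T * d) ≡ (U + T) * (c * y) + c * (U * d)
    collect = solve-∀ ℚ-ring

  binomialHarmonic≡logConvolution : ∀ {m} → m ≤ n → binomialHarmonic m ≡ logConvolution m
  binomialHarmonic≡logConvolution {zero}  _   = trans (cong (binom 0 *_) (ℚ.+-inverseʳ (H n))) (ℚ.*-zeroʳ (binom 0))
  binomialHarmonic≡logConvolution {suc t} t<n = fromℕ-suc-*-cancelˡ t (∙-cancelʳ (fromℕ t * logConvolution t) _ _ (begin
    fromℕ (suc t) * binomialHarmonic (suc t) + fromℕ t * logConvolution t
      ≡⟨ cong (λ x → fromℕ (suc t) * binomialHarmonic (suc t) + fromℕ t * x) IH ⟨
    fromℕ (suc t) * binomialHarmonic (suc t) + fromℕ t * binomialHarmonic t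
      ≡⟨ binomialHarmonic-step t t<n ⟩
    fromℕ n * binomialHarmonic t + binom t
      ≡⟨ cong (λ x → fromℕ n * x + binom t) IH ⟩
    fromℕ n * logConvolution t + binom t
      ≡⟨ logConvolution-step t ⟨
    fromℕ (suc t) * logConvolution (suc t) + fromℕ t * logConvolution t
      ∎))
    where
    open ≡-Reasoning
    IH = binomialHarmonic≡logConvolution (ℕ.<⇒≤ t<n)

*fromℕ≡fromℤ⇒≃ᵘ : ∀ x D M → x * fromℕ D ≡ fromℤ M → toℚᵘ x ℚᵘ.* ℚᵘ.mkℚᵘ (+ D) 0 ℚᵘ.≃ ℚᵘ.mkℚᵘ M 0
*fromℕ≡fromℤ⇒≃ᵘ x D M eq = begin-equality
  toℚᵘ x ℚᵘ.* ℚᵘ.mkℚᵘ (+ D) 0         ≃⟨ ℚᵘ.*-congˡ {toℚᵘ x} (toℚᵘ-fromℤ (+ D)) ⟨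
  toℚᵘ x ℚᵘ.* toℚᵘ (fromℕ D)          ≃⟨ ℚ.toℚᵘ-homo-* x (fromℕ D) ⟨
  toℚᵘ (x * fromℕ D)                  ≃⟨ ℚ.toℚᵘ-cong eq ⟩
  toℚᵘ (fromℤ M)                      ≃⟨ toℚᵘ-fromℤ M ⟩
  ℚᵘ.mkℚᵘ M 0                         ∎
  where open ℚᵘ.≤-Reasoning

*fromℕ≡fromℤ⇒∣↥∣*≡∣∣*↧ : ∀ x D M → x * fromℕ D ≡ fromℤ M → ℤ.∣ ↥ x ∣ ℕ.* D ≡ ℤ.∣ M ∣ ℕ.* ↧ₙ x
*fromℕ≡fromℤ⇒∣↥∣*≡∣∣*↧ x@(mkℚ a d _) D M eq = begin
  ℤ.∣ a ∣ ℕ.* D                         ≡⟨ ℤ.abs-* a (+ D) ⟨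
  ℤ.∣ a ℤ.* + D ∣                       ≡⟨ cong ℤ.∣_∣ (ℤ.*-identityʳ (a ℤ.* + D)) ⟨
  ℤ.∣ a ℤ.* + D ℤ.* ℤ.1ℤ ∣              ≡⟨ cong ℤ.∣_∣ (ℚᵘ.drop-*≡* (*fromℕ≡fromℤ⇒≃ᵘ x D M eq)) ⟩
  ℤ.∣ M ℤ.* + suc (d ℕ.* 1) ∣           ≡⟨ ℤ.abs-* M (+ suc (d ℕ.* 1)) ⟩
  ℤ.∣ M ∣ ℕ.* suc (d ℕ.* 1)             ≡⟨ cong (λ e → ℤ.∣ M ∣ ℕ.* suc e) (ℕ.*-identityʳ d) ⟩
  ℤ.∣ M ∣ ℕ.* suc d                     ∎
  where open ≡-Reasoning

fromℤ-*+* : ∀ a b c d → fromℤ (a ℤ.* + b ℤ.+ c ℤ.* + d) ≡ fromℤ a * fromℕ b + fromℤ c * fromℕ d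
fromℤ-*+* a b c d = trans (fromℤ-+ (a ℤ.* + b) (c ℤ.* + d)) (cong₂ _+_ (fromℤ-* a (+ b)) (fromℤ-* c (+ d)))

fraction-+ : ∀ x y b₁ b₂ → (x + y) * fromℕ (b₁ ℕ.* b₂) ≡ x * fromℕ b₁ * fromℕ b₂ + y * fromℕ b₂ * fromℕ b₁
fraction-+ x y b₁ b₂ = trans (cong ((x + y) *_) (fromℕ-* b₁ b₂)) (distrib x y (fromℕ b₁) (fromℕ b₂))
  where
  distrib : ∀ x y b₁ b₂ → (x + y) * (b₁ * b₂) ≡ x * b₁ * b₂ + y * b₂ * b₁
  distrib = solve-∀ ℚ-ring

module Localisation {p} (p-prime : Prime p) where

  private instance
    p≢0 : ℕ.NonZero p
    p≢0 = prime⇒nonZero p-prime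

  p∤1 : ¬ p ∣ 1
  p∤1 p∣1 = ℕ.<⇒≢ (ℕ.nonTrivial⇒n>1 p {{prime⇒nonTrivial p-prime}}) (sym (∣1⇒≡1 p∣1))

  p∤*p∤⇒p∤* : ∀ {m n} → ¬ p ∣ m → ¬ p ∣ n → ¬ p ∣ m ℕ.* n
  p∤*p∤⇒p∤* {m} {n} p∤m p∤n p∣mn with euclidsLemma m n p-prime p∣mn
  ... | inj₁ p∣m = p∤m p∣m
  ... | inj₂ p∣n = p∤n p∣n

  -- p·u ∣ pᵏ·b with p ∤ b is a division-free way of saying that u has p-adic valuation below k.
  <p^k⇒p*u∣p^k*b : ∀ k u → 0 < u → u < p ^ k → ∃ λ b → ¬ p ∣ b × p ℕ.* u ∣ p ^ k ℕ.* b
  <p^k⇒p*u∣p^k*b zero    (suc _) _ (s≤s ())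
  <p^k⇒p*u∣p^k*b (suc k) u 0<u u<p^[1+k] with p ∣? u
  ... | no  p∤u = u , p∤u , divides (p ^ k) (reorder p (p ^ k) u)
    where
    reorder : ∀ p q u → p ℕ.* q ℕ.* u ≡ q ℕ.* (p ℕ.* u)
    reorder = ℕ-solve-∀
  ... | yes (divides q refl) =
    let b , p∤b , p*q∣p^k*b = <p^k⇒p*u∣p^k*b k q 0<q q<p^k
    in b , p∤b , subst₂ _∣_ (cong (p ℕ.*_) (ℕ.*-comm p q)) (sym (ℕ.*-assoc p (p ^ k) b)) (*-monoʳ-∣ p p*q∣p^k*b)
    where
    0<q : 0 < q
    0<q = ℕ.>-nonZero⁻¹ q {{ℕ.m*n≢0⇒m≢0 q {{ℕ.>-nonZero 0<u}}}}
    q<p^k : q < p ^ k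
    q<p^k = ℕ.*-cancelʳ-< p q (p ^ k) (subst (q ℕ.* p <_) (ℕ.*-comm p (p ^ k)) u<p^[1+k])

  p∤m∧p^k∣m*n⇒p^k∣n : ∀ {m} → ¬ p ∣ m → ∀ k n → p ^ k ∣ m ℕ.* n → p ^ k ∣ n
  p∤m∧p^k∣m*n⇒p^k∣n p∤m zero    n _ = 1∣ n
  p∤m∧p^k∣m*n⇒p^k∣n {m} p∤m (suc k) n p^[1+k]∣m*n with euclidsLemma m n p-prime (∣-trans (m∣m*n (p ^ k)) p^[1+k]∣m*n)
  ... | inj₁ p∣m = ⊥-elim (p∤m p∣m)
  ... | inj₂ (divides n′ refl) = subst (p ℕ.* p ^ k ∣_) (ℕ.*-comm p n′)
      (*-monoʳ-∣ p (p∤m∧p^k∣m*n⇒p^k∣n p∤m k n′ (*-cancelˡ-∣ p (subst (p ℕ.* p ^ k ∣_) (reorder m n′ p) p^[1+k]∣m*n))))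
    where
    reorder : ∀ m n p → m ℕ.* (n ℕ.* p) ≡ p ℕ.* (m ℕ.* n)
    reorder = ℕ-solve-∀

  coprime∧*≡*⇒p^k∣d∧p^[1+k]∤d : ∀ {a d M b} k .{{_ : ℕ.NonZero d}} → Coprime a d →
                               a ℕ.* (p ^ k ℕ.* b) ≡ M ℕ.* d → ¬ p ∣ b → ¬ p ∣ M →
                               p ^ k ∣ d × ¬ p ^ suc k ∣ d
  coprime∧*≡*⇒p^k∣d∧p^[1+k]∤d {a} {d} {M} {b} k a⊥d a*p^kb≡M*d p∤b p∤M
    with coprime-divisor (Coprime.sym a⊥d) (divides M a*p^kb≡M*d)
  ... | divides g p^kb≡g*d = p∤m∧p^k∣m*n⇒p^k∣n p∤g k d (subst (p ^ k ∣_) p^kb≡g*d (m∣m*n b)) , p^[1+k]∤d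
    where
    instance
      p^k≢0 : ℕ.NonZero (p ^ k)
      p^k≢0 = ℕ.m^n≢0 p k
    a*g≡M : a ℕ.* g ≡ M
    a*g≡M = ℕ.*-cancelʳ-≡ (a ℕ.* g) M d (trans (ℕ.*-assoc a g d) (trans (cong (a ℕ.*_) (sym p^kb≡g*d)) a*p^kb≡M*d))
    p∤g : ¬ p ∣ g
    p∤g p∣g = p∤M (subst (p ∣_) a*g≡M (∣-trans p∣g (n∣m*n a)))
    p^[1+k]∤d : ¬ p ^ suc k ∣ d
    p^[1+k]∤d p^[1+k]∣d = p∤b (*-cancelˡ-∣ (p ^ k)
      (subst (_∣ p ^ k ℕ.* b) (ℕ.*-comm p (p ^ k)) (∣-trans p^[1+k]∣d (divides g p^kb≡g*d))))

  -- The maximal ideal pℤ₍ₚ₎ and the unit group ℤ₍ₚ₎ˣ of ℤ localised at p, with the denominator b cleared.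
  infix 4 _∈pℤ₍ₚ₎ _∈ℤ₍ₚ₎ˣ

  _∈pℤ₍ₚ₎ : ℚ → Set
  x ∈pℤ₍ₚ₎ = ∃₂ λ a b → ¬ p ∣ b × x * fromℕ b ≡ fromℕ p * fromℤ a

  _∈ℤ₍ₚ₎ˣ : ℚ → Set
  x ∈ℤ₍ₚ₎ˣ = ∃₂ λ a b → ¬ p ∣ b × ¬ p ∣ ℤ.∣ a ∣ × x * fromℕ b ≡ fromℤ a

  0∈pℤ₍ₚ₎ : 0ℚ ∈pℤ₍ₚ₎
  0∈pℤ₍ₚ₎ = ℤ.0ℤ , 1 , p∤1 , trans (ℚ.*-zeroˡ (fromℕ 1)) (sym (ℚ.*-zeroʳ (fromℕ p)))

  +-∈pℤ₍ₚ₎ : ∀ {x y} → x ∈pℤ₍ₚ₎ → y ∈pℤ₍ₚ₎ → x + y ∈pℤ₍ₚ₎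
  +-∈pℤ₍ₚ₎ {x} {y} (a₁ , b₁ , p∤b₁ , eq₁) (a₂ , b₂ , p∤b₂ , eq₂) =
    a₁ ℤ.* + b₂ ℤ.+ a₂ ℤ.* + b₁ , b₁ ℕ.* b₂ , p∤*p∤⇒p∤* p∤b₁ p∤b₂ , (begin
      (x + y) * fromℕ (b₁ ℕ.* b₂)
        ≡⟨ fraction-+ x y b₁ b₂ ⟩
      x * fromℕ b₁ * fromℕ b₂ + y * fromℕ b₂ * fromℕ b₁
        ≡⟨ cong₂ (λ u v → u * fromℕ b₂ + v * fromℕ b₁) eq₁ eq₂ ⟩
      fromℕ p * fromℤ a₁ * fromℕ b₂ + fromℕ p * fromℤ a₂ * fromℕ b₁
        ≡⟨ factor (fromℕ p) (fromℤ a₁) (fromℕ b₂) (fromℤ a₂) (fromℕ b₁) ⟩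
      fromℕ p * (fromℤ a₁ * fromℕ b₂ + fromℤ a₂ * fromℕ b₁)
        ≡⟨ cong (fromℕ p *_) (fromℤ-*+* a₁ b₂ a₂ b₁) ⟨
      fromℕ p * fromℤ (a₁ ℤ.* + b₂ ℤ.+ a₂ ℤ.* + b₁)
        ∎)
    where
    open ≡-Reasoning
    factor : ∀ p a b c d → p * a * b + p * c * d ≡ p * (a * b + c * d)
    factor = solve-∀ ℚ-ring

  ∈ℤ₍ₚ₎ˣ-+-∈pℤ₍ₚ₎ : ∀ {x y} → x ∈ℤ₍ₚ₎ˣ → y ∈pℤ₍ₚ₎ → x + y ∈ℤ₍ₚ₎ˣ
  ∈ℤ₍ₚ₎ˣ-+-∈pℤ₍ₚ₎ {x} {y} (M , b₁ , p∤b₁ , p∤M , eq₁) (a , b₂ , p∤b₂ , eq₂) =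
    N , b₁ ℕ.* b₂ , p∤*p∤⇒p∤* p∤b₁ p∤b₂ , p∤N , (begin
      (x + y) * fromℕ (b₁ ℕ.* b₂)
        ≡⟨ fraction-+ x y b₁ b₂ ⟩
      x * fromℕ b₁ * fromℕ b₂ + y * fromℕ b₂ * fromℕ b₁
        ≡⟨ cong₂ (λ u v → u * fromℕ b₂ + v * fromℕ b₁) eq₁ eq₂ ⟩
      fromℤ M * fromℕ b₂ + fromℕ p * fromℤ a * fromℕ b₁
        ≡⟨ cong (λ z → fromℤ M * fromℕ b₂ + z * fromℕ b₁) (fromℤ-* (+ p) a) ⟨
      fromℤ M * fromℕ b₂ + fromℤ (+ p ℤ.* a) * fromℕ b₁
        ≡⟨ fromℤ-*+* M b₂ (+ p ℤ.* a) b₁ ⟨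
      fromℤ N
        ∎)
    where
    open ≡-Reasoning
    N = M ℤ.* + b₂ ℤ.+ (+ p ℤ.* a) ℤ.* + b₁
    p∤N : ¬ p ∣ ℤ.∣ N ∣
    p∤N p∣N = p∤*p∤⇒p∤* p∤M p∤b₂ (subst (p ∣_) (ℤ.abs-* M (+ b₂)) (ℤ∣.∣⇒∣ᵤ (ℤ∣.∣m+n∣n⇒∣m {+ p} {M ℤ.* + b₂}
                (ℤ∣.∣ᵤ⇒∣ p∣N) (ℤ∣.∣m⇒∣m*n (+ b₁) (ℤ∣.∣m⇒∣m*n a (ℤ∣.∣-refl {+ p}))))))

  sum-∈pℤ₍ₚ₎ : ∀ {m} (f : Fin m → ℚ) → (∀ i → f i ∈pℤ₍ₚ₎) → sum f ∈pℤ₍ₚ₎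
  sum-∈pℤ₍ₚ₎ {zero}  f _ = 0∈pℤ₍ₚ₎
  sum-∈pℤ₍ₚ₎ {suc m} f f∈ = +-∈pℤ₍ₚ₎ {f Fin.zero} {sum (f ∘ Fin.suc)} (f∈ Fin.zero) (sum-∈pℤ₍ₚ₎ (f ∘ Fin.suc) (f∈ ∘ Fin.suc))

  *-fromℤ-∈pℤ₍ₚ₎ : ∀ {x} z → x ∈pℤ₍ₚ₎ → x * fromℤ z ∈pℤ₍ₚ₎
  *-fromℤ-∈pℤ₍ₚ₎ {x} z (a , b , p∤b , eq) = a ℤ.* z , b , p∤b , (begin
    x * fromℤ z * fromℕ b           ≡⟨ xy∙z≈xz∙y x (fromℤ z) (fromℕ b) ⟩
    x * fromℕ b * fromℤ z           ≡⟨ cong (_* fromℤ z) eq ⟩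
    fromℕ p * fromℤ a * fromℤ z     ≡⟨ ℚ.*-assoc (fromℕ p) (fromℤ a) (fromℤ z) ⟩
    fromℕ p * (fromℤ a * fromℤ z)   ≡⟨ cong (fromℕ p *_) (fromℤ-* a z) ⟨
    fromℕ p * fromℤ (a ℤ.* z)       ∎)
    where open ≡-Reasoning

  sign∈ℤ₍ₚ₎ˣ : ∀ j → fromℤ (sign j) ∈ℤ₍ₚ₎ˣ
  sign∈ℤ₍ₚ₎ˣ j = sign j , 1 , p∤1 , subst (λ m → ¬ p ∣ m) (sym (∣sign∣≡1 j)) p∤1 , ℚ.*-identityʳ (fromℤ (sign j))

  p^k*logCoeff∈pℤ₍ₚ₎ : ∀ k {u} → 0 < u → u < p ^ k → fromℕ (p ^ k) * logCoeff u ∈pℤ₍ₚ₎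
  p^k*logCoeff∈pℤ₍ₚ₎ k {suc j} 0<u u<p^k with <p^k⇒p*u∣p^k*b k (suc j) 0<u u<p^k
  ... | b , p∤b , divides a p^k*b≡a*[p*u] = sign (suc j) ℤ.* + a , b , p∤b , (begin
    fromℕ (p ^ k) * (σ * r) * fromℕ b                ≡⟨ xy∙z≈y∙xz (fromℕ (p ^ k)) (σ * r) (fromℕ b) ⟩
    σ * r * (fromℕ (p ^ k) * fromℕ b)                ≡⟨ cong (σ * r *_) (fromℕ-* (p ^ k) b) ⟨
    σ * r * fromℕ (p ^ k ℕ.* b)                      ≡⟨ cong (λ z → σ * r * fromℕ z) p^k*b≡a*[p*u] ⟩
    σ * r * fromℕ (a ℕ.* (p ℕ.* suc j))              ≡⟨ cong (σ * r *_) (trans (fromℕ-* a _) (cong (fromℕ a *_) (fromℕ-* p (suc j)))) ⟩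
    σ * r * (fromℕ a * (fromℕ p * fromℕ (suc j)))    ≡⟨ regroup σ r (fromℕ a) (fromℕ p) (fromℕ (suc j)) ⟩
    fromℕ p * (σ * fromℕ a) * (fromℕ (suc j) * r)   ≡⟨ cong (fromℕ p * (σ * fromℕ a) *_) (fromℕ*recip j) ⟩
    fromℕ p * (σ * fromℕ a) * 1ℚ                     ≡⟨ ℚ.*-identityʳ _ ⟩
    fromℕ p * (σ * fromℕ a)                          ≡⟨ cong (fromℕ p *_) (fromℤ-* (sign (suc j)) (+ a)) ⟨
    fromℕ p * fromℤ (sign (suc j) ℤ.* + a)           ∎)
    where
    open ≡-Reasoning
    σ = fromℤ (sign (suc j))
    r = recip (suc j)
    regroup : ∀ σ r a p u → σ * r * (a * (p * u)) ≡ p * (σ * a) * (u * r)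
    regroup = solve-∀ ℚ-ring

  logConvolution[p^k]*p^k∈ℤ₍ₚ₎ˣ : ∀ n k → logConvolution n (p ^ k) * fromℕ (p ^ k) ∈ℤ₍ₚ₎ˣ
  logConvolution[p^k]*p^k∈ℤ₍ₚ₎ˣ n k = helper (p ^ k) refl
    where
    helper : ∀ m → m ≡ p ^ k → logConvolution n m * fromℕ m ∈ℤ₍ₚ₎ˣ
    helper zero    0≡p^k = ⊥-elim (ℕ.<⇒≢ (ℕ.m^n>0 p k) 0≡p^k)
    helper (suc t) 1+t≡p^k = subst _∈ℤ₍ₚ₎ˣ (sym (ℚ.*-distribʳ-+ M leading rest))
      (∈ℤ₍ₚ₎ˣ-+-∈pℤ₍ₚ₎ {leading * M} {rest * M} leading∈ rest∈)
      where
      M = fromℕ (suc t)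
      leading = logTerm n (suc t) 0
      rest = ∑[ i < t ] logTerm n (suc t) (suc (toℕ i))
      leading*M≡sign : fromℤ (sign (suc t)) ≡ leading * M
      leading*M≡sign = begin
        fromℤ (sign (suc t))              ≡⟨ fromℕ*logCoeff t ⟨
        M * logCoeff (suc t)              ≡⟨ ℚ.*-comm M (logCoeff (suc t)) ⟩
        logCoeff (suc t) * M              ≡⟨ cong (_* M) (ℚ.*-identityʳ (logCoeff (suc t))) ⟨
        logCoeff (suc t) * 1ℚ * M         ∎
        where open ≡-Reasoning
      leading∈ : leading * M ∈ℤ₍ₚ₎ˣ
      leading∈ = subst _∈ℤ₍ₚ₎ˣ leading*M≡sign (sign∈ℤ₍ₚ₎ˣ (suc t))
      rest∈ : rest * M ∈pℤ₍ₚ₎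
      rest∈ = subst _∈pℤ₍ₚ₎ (sym (*-distribʳ-sum {t} M _)) (sum-∈pℤ₍ₚ₎ _ term∈)
        where
        term∈ : ∀ (i : Fin t) → logTerm n (suc t) (suc (toℕ i)) * M ∈pℤ₍ₚ₎
        term∈ i = subst _∈pℤ₍ₚ₎ (xy∙z≈yz∙x M (logCoeff u) (binom n (suc (toℕ i))))
                    (*-fromℤ-∈pℤ₍ₚ₎ {M * logCoeff u} (+ (n C suc (toℕ i))) M*logCoeff[u]∈)
          where
          u = t ∸ toℕ i
          M*logCoeff[u]∈ : M * logCoeff u ∈pℤ₍ₚ₎
          M*logCoeff[u]∈ = subst (λ m → fromℕ m * logCoeff u ∈pℤ₍ₚ₎) (sym 1+t≡p^k)
            (p^k*logCoeff∈pℤ₍ₚ₎ k (ℕ.m<n⇒0<n∸m (Fin.toℕ<n i)) (subst (u <_) 1+t≡p^k (s≤s (ℕ.m∸n≤m t (toℕ i)))))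

  *p^k∈ℤ₍ₚ₎ˣ⇒p^k∣↧∧p^[1+k]∤↧ : ∀ k x → x * fromℕ (p ^ k) ∈ℤ₍ₚ₎ˣ → p ^ k ∣ ↧ₙ x × ¬ p ^ suc k ∣ ↧ₙ x
  *p^k∈ℤ₍ₚ₎ˣ⇒p^k∣↧∧p^[1+k]∤↧ k x@(mkℚ _ _ a⊥d) (M , b , p∤b , p∤M , eq) =
    coprime∧*≡*⇒p^k∣d∧p^[1+k]∤d k (Coprime.recompute a⊥d)
      (*fromℕ≡fromℤ⇒∣↥∣*≡∣∣*↧ x (p ^ k ℕ.* b) M x*p^kb≡M) p∤b p∤M
    where
    x*p^kb≡M : x * fromℕ (p ^ k ℕ.* b) ≡ fromℤ M
    x*p^kb≡M = trans (cong (x *_) (fromℕ-* (p ^ k) b)) (trans (sym (ℚ.*-assoc x (fromℕ (p ^ k)) (fromℕ b))) eq)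

lemma3p2 : (p n k : ℕ) → Prime p → 1 ≤ n → p ^ k ≤ n →
           let q = ((+ (n C (p ^ k))) / 1) * (H n - H (n ∸ p ^ k))
           in (p ^ k ∣ ↧ₙ q) × ¬ (p ^ suc k ∣ ↧ₙ q)
lemma3p2 p n k p-prime _ p^k≤n =   -- 1 ≤ n is implied by p ^ k ≤ n
  *p^k∈ℤ₍ₚ₎ˣ⇒p^k∣↧∧p^[1+k]∤↧ k (binomialHarmonic n (p ^ k))
    (subst (λ x → x * fromℕ (p ^ k) ∈ℤ₍ₚ₎ˣ) (sym (binomialHarmonic≡logConvolution n p^k≤n))
      (logConvolution[p^k]*p^k∈ℤ₍ₚ₎ˣ n k))
  where open Localisation p-prime
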